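{- Let $n$ be a positive integer. Let $L= \{\frac{a_1}{b_1}, \ldots , \frac{a_s}{b_s}\}$, where for every $i \in [s]$, $\frac{a_i}{b_i} \in [0,1)$ is an irreducible fraction, and let $\frac{a}{b} = \max(\frac{a_1}{b_1}, \ldots , \frac{a_s}{b_s})$. Let $\alpha = \max(\frac{1}{2}, \frac{4a - b}{2b})$. Let $\mathcal{F}$ be a fractional $L$-intersecting family of subsets of $[n]$ such that $|A| > \alpha n$ for every $A \in \mathcal{F}$. Then $|\mathcal{F}| \leq n$.
   Context: $[n]=\{1,\ldots,n\}$. A family $\mathcal{F}=\{A_1,\ldots,A_m\}$ of (distinct) subsets of $[n]$ is a fractional $L$-intersecting family if for every distinct $i,j\in[m]$ there exists $\frac{a}{b}\in L$ such that $|A_i\cap A_j|\in\{\frac{a}{b}|A_i|,\frac{a}{b}|A_j|\}$. -}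

module Defs where

open import Data.Nat using (ℕ; _*_; _+_; _<_; _≤_)
open import Data.Nat.GCD using (gcd)
open import Data.Fin using (Fin)
open import Data.Fin.Subset using (Subset; _∩_; ∣_∣)
open import Data.Product using (_×_; ∃; _,_)
open import Data.Sum using (_⊎_)
open import Data.List using (List)
open import Data.List.Membership.Propositional using (_∈_)
open import Data.List.Relation.Unary.All using (All)
open import Relation.Binary.PropositionalEquality using (_≡_)
open import Relation.Nullary using (¬_)

Frac : Set
Frac = ℕ × ℕ

-- a/b is an irreducible fraction lying in [0,1): gcd a b = 1 and a < b
-- (this forces b ≥ 1).
IrredIn01 : Frac → Set
IrredIn01 (a , b) = (gcd a b ≡ 1) × (a < b)

-- x = (a/b) * y, cleared of denominators.
IsFracOf : Frac → ℕ → ℕ → Set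
IsFracOf (a , b) x y = b * x ≡ a * y

FractionalLIntersecting : ∀ {n m} → List Frac → (Fin m → Subset n) → Set
FractionalLIntersecting {n} {m} L F =
  ∀ (i j : Fin m) → ¬ (i ≡ j) →
    ∃ λ q → q ∈ L ×
      (IsFracOf q (∣ F i ∩ F j ∣) (∣ F i ∣) ⊎ IsFracOf q (∣ F i ∩ F j ∣) (∣ F j ∣))

IsMax : Frac → List Frac → Set
IsMax (a , b) L = ((a , b) ∈ L) × All (λ { (a' , b') → a' * b ≤ a * b' }) L

-- |A| > α n where α = max(1/2, (4a - b)/(2b)), cleared of denominators:
-- 2|A| > n  and  2b|A| + b n > 4 a n (rational subtraction, so 4a - b may be negative).
AboveAlpha : Frac → ℕ → ℕ → Set
AboveAlpha (a , b) n k = (n < 2 * k) × (4 * a * n < 2 * b * k + b * n)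

module Submission where

-- Proof idea (a sign-vector version of the classical "obtuse vectors" bound).
-- Encode A ⊆ [n] as its ±1 vector v_A ∈ ℤⁿ (+1 on A, -1 off A). Then
--   v_A · v_B = 4|A ∩ B| + n - 2|A| - 2|B|   and   v_A · 𝟙 = 2|A| - n.
-- The size condition |A| > n/2 makes every v_A · 𝟙 positive, and the
-- fractional L-intersecting condition together with |B| > (4a-b)n/(2b)
-- forces 4|A ∩ B| + n < 2|A| + 2|B|, i.e. v_A · v_B < 0 for A ≠ B.
-- Vectors in ℤⁿ that are pairwise obtuse and all strictly on the positive
-- side of one vector w are linearly independent: splitting a dependence
-- c = c⁺ - c⁻ gives u = Σ c⁺ᵢ vᵢ = Σ c⁻ᵢ vᵢ with u · u ≤ 0, so u = 0, and
-- then 0 = u · w = Σ c±ᵢ (vᵢ · w) kills every coefficient. Independent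
-- vectors in ℤⁿ number at most n, since n+1 vectors always admit a
-- nontrivial integer dependence (fraction-free Gaussian elimination).

open import Defs

module IntegerVectors where

  open import Data.Nat using (ℕ; zero; suc; z≤n)
  open import Data.Integer using (ℤ; +_; -[1+_]; 0ℤ; _+_; _*_; _-_; _≤_; +≤+; nonNegative)
  open import Data.Integer.Tactic.RingSolver using (solve-∀)
  open import Data.Integer.Properties
    using (+-*-semiring; *-comm; *-assoc; *-zeroʳ; ≤-refl; ≤-reflexive; ≤-trans; ≤-antisym;
           +-mono-≤; i≤i+j; i≤j+i; *-monoˡ-≤-nonNeg; i*j≡0⇒i≡0∨j≡0)
  open import Data.Fin using (Fin; zero; suc)
  open import Data.Vec.Functional using (Vector)
  open import Data.Sum using (inj₁; inj₂)
  open import Function using (_∘_)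
  open import Relation.Binary.PropositionalEquality
  open import Algebra.Properties.Semiring.Sum +-*-semiring public
    using (sum; sum-syntax; ∑-distrib-+; ∑-comm; *-distribˡ-sum; *-distribʳ-sum; sum-cong-≗; sum-remove; sum-replicate-zero)

  private
    variable
      m n : ℕ

  infix 8 _·_
  _·_ : Vector ℤ n → Vector ℤ n → ℤ
  _·_ {n} x y = ∑[ k < n ] (x k * y k)

  ·-comm : (x y : Vector ℤ n) → x · y ≡ y · x
  ·-comm x y = sum-cong-≗ (λ k → *-comm (x k) (y k))

  combination : (Fin m → ℤ) → (Fin m → Vector ℤ n) → Vector ℤ n
  combination {m} c v k = ∑[ i < m ] (c i * v i k)

  combination-· : (c : Fin m → ℤ) (v : Fin m → Vector ℤ n) (y : Vector ℤ n) →
    combination c v · y ≡ ∑[ i < m ] (c i * (v i · y))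
  combination-· {m} {n} c v y = begin
    ∑[ k < n ] (∑[ i < m ] (c i * v i k) * y k)   ≡⟨ sum-cong-≗ (λ k → *-distribʳ-sum (y k) (λ i → c i * v i k)) ⟩
    ∑[ k < n ] ∑[ i < m ] (c i * v i k * y k)     ≡⟨ ∑-comm (λ k i → c i * v i k * y k) ⟩
    ∑[ i < m ] ∑[ k < n ] (c i * v i k * y k)     ≡⟨ sum-cong-≗ (λ i → sum-cong-≗ (λ k → *-assoc (c i) (v i k) (y k))) ⟩
    ∑[ i < m ] ∑[ k < n ] (c i * (v i k * y k))   ≡⟨ sum-cong-≗ (λ i → sym (*-distribˡ-sum (c i) (λ k → v i k * y k))) ⟩
    ∑[ i < m ] (c i * (v i · y))                  ∎
    where open ≡-Reasoning

  combination-difference : (p q : Fin m → ℤ) (v : Fin m → Vector ℤ n) → ∀ k →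
    combination (λ i → p i - q i) v k ≡ combination p v k - combination q v k
  combination-difference {zero} p q v k = refl
  combination-difference {suc m} p q v k =
    trans (cong (_+_ ((p zero - q zero) * v zero k)) (combination-difference (p ∘ suc) (q ∘ suc) (v ∘ suc) k))
          (regroup (p zero) (q zero) (v zero k) (combination (p ∘ suc) (v ∘ suc) k) (combination (q ∘ suc) (v ∘ suc) k))
    where
    regroup : ∀ p q x P Q → (p - q) * x + (P - Q) ≡ (p * x + P) - (q * x + Q)
    regroup = solve-∀

  sum-nonneg : (f : Vector ℤ n) → (∀ i → 0ℤ ≤ f i) → 0ℤ ≤ sum f
  sum-nonneg {zero} f f≥0 = ≤-refl
  sum-nonneg {suc n} f f≥0 = +-mono-≤ (f≥0 zero) (sum-nonneg (f ∘ suc) (f≥0 ∘ suc))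

  sum-nonpos : (f : Vector ℤ n) → (∀ i → f i ≤ 0ℤ) → sum f ≤ 0ℤ
  sum-nonpos {zero} f f≤0 = ≤-refl
  sum-nonpos {suc n} f f≤0 = +-mono-≤ (f≤0 zero) (sum-nonpos (f ∘ suc) (f≤0 ∘ suc))

  sum-nonneg-vanishes : (f : Vector ℤ n) → (∀ i → 0ℤ ≤ f i) → sum f ≤ 0ℤ → ∀ i → f i ≡ 0ℤ
  sum-nonneg-vanishes f f≥0 Σ≤0 zero =
    ≤-antisym (≤-trans (i≤i+j (f zero) _) Σ≤0) (f≥0 zero)
    where instance _ = nonNegative (sum-nonneg (f ∘ suc) (f≥0 ∘ suc))
  sum-nonneg-vanishes f f≥0 Σ≤0 (suc i) =
    sum-nonneg-vanishes (f ∘ suc) (f≥0 ∘ suc) (≤-trans (i≤j+i _ (f zero)) Σ≤0) i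
    where instance _ = nonNegative (f≥0 zero)

  *-nonneg : ∀ {a b} → 0ℤ ≤ a → 0ℤ ≤ b → 0ℤ ≤ a * b
  *-nonneg {a} {b} 0≤a 0≤b =
    ≤-trans (≤-reflexive (sym (*-zeroʳ a))) (*-monoˡ-≤-nonNeg a 0≤b)
    where instance _ = nonNegative 0≤a

  *-nonneg-nonpos : ∀ {a b} → 0ℤ ≤ a → b ≤ 0ℤ → a * b ≤ 0ℤ
  *-nonneg-nonpos {a} {b} 0≤a b≤0 =
    ≤-trans (*-monoˡ-≤-nonNeg a b≤0) (≤-reflexive (*-zeroʳ a))
    where instance _ = nonNegative 0≤a

  square-nonneg : ∀ x → 0ℤ ≤ x * x
  square-nonneg (+ n) = *-nonneg {+ n} {+ n} (+≤+ z≤n) (+≤+ z≤n)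
  square-nonneg -[1+ n ] = +≤+ z≤n

  self-·-nonpos : (x : Vector ℤ n) → x · x ≤ 0ℤ → ∀ k → x k ≡ 0ℤ
  self-·-nonpos x x·x≤0 k with i*j≡0⇒i≡0∨j≡0 (x k) (sum-nonneg-vanishes _ (λ k → square-nonneg (x k)) x·x≤0 k)
  ... | inj₁ xk≡0 = xk≡0
  ... | inj₂ xk≡0 = xk≡0

-- More than n vectors in ℤⁿ admit a nontrivial integer dependence.
-- The proof is fraction-free Gaussian elimination on the first coordinate.
module Dependences where

  open IntegerVectors
  open import Data.Nat using (ℕ; zero; suc; _<_; s≤s)
  open import Data.Nat.Properties using (m≤n⇒m≤1+n)
  open import Data.Integer using (ℤ; 0ℤ; 1ℤ; _+_; _*_; _-_; -_; _≟_)
  open import Data.Integer.Properties using (*-zeroʳ; i*j≡0⇒i≡0∨j≡0)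
  open import Data.Integer.Tactic.RingSolver using (solve-∀)
  open import Data.Fin using (Fin; zero; suc; punchIn)
  open import Data.Fin.Properties using (any?)
  open import Data.Vec.Functional using (Vector; tail; insertAt; replicate)
  open import Data.Vec.Functional.Properties using (insertAt-lookup; insertAt-punchIn)
  open import Data.Product using (∃; _×_; _,_)
  open import Data.Sum using ([_,_]′)
  open import Relation.Nullary using (¬_; yes; no; ¬?)
  open import Relation.Nullary.Decidable using (decidable-stable)
  open import Relation.Binary.PropositionalEquality

  private
    variable
      m n : ℕ

  IsDependence : (Fin m → ℤ) → (Fin m → Vector ℤ n) → Set
  IsDependence c v = ∀ k → combination c v k ≡ 0ℤ

  NonTrivial : (Fin m → ℤ) → Set
  NonTrivial c = ∃ λ i → ¬ (c i ≡ 0ℤ)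

  dependence-from-tails : (c : Fin m → ℤ) (v : Fin m → Vector ℤ (suc n)) →
    (∀ i → v i zero ≡ 0ℤ) → IsDependence c (λ i → tail (v i)) → IsDependence c v
  dependence-from-tails {m} c v first≡0 dep zero = begin
    ∑[ i < m ] (c i * v i zero)  ≡⟨ sum-cong-≗ (λ i → trans (cong (c i *_) (first≡0 i)) (*-zeroʳ (c i))) ⟩
    sum (replicate m 0ℤ)         ≡⟨ sum-replicate-zero m ⟩
    0ℤ                           ∎
    where open ≡-Reasoning
  dependence-from-tails c v first≡0 dep (suc k) = dep k

  eliminate : (v : Fin (suc m) → Vector ℤ (suc n)) → Fin (suc m) → Fin m → Vector ℤ (suc n)
  eliminate v p j k = v p zero * v (punchIn p j) k - v (punchIn p j) zero * v p k

  eliminate-first : (v : Fin (suc m) → Vector ℤ (suc n)) (p : Fin (suc m)) →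
    ∀ j → eliminate v p j zero ≡ 0ℤ
  eliminate-first v p j = cancel (v p zero) (v (punchIn p j) zero)
    where
    cancel : ∀ d x → d * x - x * d ≡ 0ℤ
    cancel = solve-∀

  lift : (v : Fin (suc m) → Vector ℤ (suc n)) → Fin (suc m) → (Fin m → ℤ) → Fin (suc m) → ℤ
  lift {m} v p c' = insertAt (λ j → v p zero * c' j) p (- ∑[ j < m ] (c' j * v (punchIn p j) zero))

  lift-combination : (v : Fin (suc m) → Vector ℤ (suc n)) (p : Fin (suc m)) (c' : Fin m → ℤ) →
    ∀ k → combination (lift v p c') v k ≡ combination c' (eliminate v p) k
  lift-combination {m} v p c' k = begin
    combination (lift v p c') v k
      ≡⟨ sum-remove {i = p} (λ i → lift v p c' i * v i k) ⟩
    lift v p c' p * v p k + ∑[ j < m ] (lift v p c' (punchIn p j) * u j k)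
      ≡⟨ cong₂ _+_ (cong (_* v p k) (insertAt-lookup d·c' p (- S)))
                   (sum-cong-≗ (λ j → cong (_* u j k) (insertAt-punchIn d·c' p (- S) j))) ⟩
    - S * v p k + T
      ≡⟨ regroup S (v p k) T ⟩
    T + - v p k * S
      ≡⟨ cong (T +_) (*-distribˡ-sum (- v p k) (λ j → c' j * u j zero)) ⟩
    T + ∑[ j < m ] (- v p k * (c' j * u j zero))
      ≡⟨ ∑-distrib-+ (λ j → d * c' j * u j k) (λ j → - v p k * (c' j * u j zero)) ⟨
    ∑[ j < m ] (d * c' j * u j k + - v p k * (c' j * u j zero))
      ≡⟨ sum-cong-≗ (λ j → expand (c' j) d (u j k) (u j zero) (v p k)) ⟩
    combination c' (eliminate v p) k ∎
    where
    open ≡-Reasoning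
    d = v p zero
    u = λ j → v (punchIn p j)
    d·c' = λ j → d * c' j
    S = ∑[ j < m ] (c' j * u j zero)
    T = ∑[ j < m ] (d * c' j * u j k)
    regroup : ∀ S y T → - S * y + T ≡ T + - y * S
    regroup = solve-∀
    expand : ∀ c d x x₀ y → d * c * x + - y * (c * x₀) ≡ c * (d * x - x₀ * y)
    expand = solve-∀

  lift-nontrivial : (v : Fin (suc m) → Vector ℤ (suc n)) (p : Fin (suc m)) (c' : Fin m → ℤ) →
    ¬ (v p zero ≡ 0ℤ) → NonTrivial c' → NonTrivial (lift v p c')
  lift-nontrivial v p c' pivot≢0 (j , c'ⱼ≢0) = punchIn p j , λ liftⱼ≡0 →
    [ pivot≢0 , c'ⱼ≢0 ]′ (i*j≡0⇒i≡0∨j≡0 (v p zero)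
      (trans (sym (insertAt-punchIn (λ j → v p zero * c' j) p _ j)) liftⱼ≡0))

  dependent : ∀ n {m} → n < m → (v : Fin m → Vector ℤ n) →
    ∃ λ c → NonTrivial c × IsDependence c v
  dependent zero {suc m} _ v = unit , (zero , λ ()) , λ ()
    where
    unit : Fin (suc m) → ℤ
    unit zero = 1ℤ
    unit (suc _) = 0ℤ
  dependent (suc n) {suc m} (s≤s n<m) v with any? (λ p → ¬? (v p zero ≟ 0ℤ))
  ... | no noPivot =
    let (c , nontrivial , dep) = dependent n (m≤n⇒m≤1+n n<m) (λ i → tail (v i))
    in c , nontrivial , dependence-from-tails c v first≡0 dep
    where
    first≡0 : ∀ i → v i zero ≡ 0ℤ
    first≡0 i = decidable-stable (v i zero ≟ 0ℤ) (λ ne → noPivot (i , ne))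
  ... | yes (p , pivot≢0) =
    let (c' , nontrivial , dep) = dependent n n<m (λ j → tail (eliminate v p j))
    in lift v p c' , lift-nontrivial v p c' pivot≢0 nontrivial ,
       λ k → trans (lift-combination v p c' k)
                   (dependence-from-tails c' (eliminate v p) (eliminate-first v p) dep k)

module ObtuseFamilies where

  open IntegerVectors
  open Dependences
  open import Data.Nat as ℕ using (suc)
  open import Data.Nat.Properties using (≰⇒>)
  open import Data.Integer using (ℤ; +_; -[1+_]; 0ℤ; _*_; _-_; _≤_; _<_; +≤+)
  open import Data.Integer.Properties
    using (≤-refl; ≤-trans; ≤-reflexive; <⇒≤; <⇒≢; +-identityʳ; i*j≡0⇒i≡0∨j≡0; i-j≡0⇒i≡j)
  open import Data.Fin using (Fin) renaming (_≟_ to _≟ᶠ_)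
  open import Data.Vec.Functional using (Vector; replicate)
  open import Data.Product using (_,_)
  open import Data.Sum using (_⊎_; inj₁; inj₂)
  open import Relation.Nullary using (¬_; yes; no; contradiction)
  open import Relation.Binary.PropositionalEquality
  open import Function using (_∘_)

  _⁺ _⁻ : ℤ → ℤ
  (+ n) ⁺ = + n
  -[1+ n ] ⁺ = 0ℤ
  (+ n) ⁻ = 0ℤ
  -[1+ n ] ⁻ = + suc n

  ⁺-nonneg : ∀ x → 0ℤ ≤ x ⁺
  ⁺-nonneg (+ n) = +≤+ ℕ.z≤n
  ⁺-nonneg -[1+ n ] = ≤-refl

  ⁻-nonneg : ∀ x → 0ℤ ≤ x ⁻
  ⁻-nonneg (+ n) = ≤-refl
  ⁻-nonneg -[1+ n ] = +≤+ ℕ.z≤n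

  ⁺-⁻-split : ∀ x → x ≡ x ⁺ - x ⁻
  ⁺-⁻-split (+ n) = sym (+-identityʳ (+ n))
  ⁺-⁻-split -[1+ n ] = refl

  ⁺-⁻-disjoint : ∀ x → x ⁺ ≡ 0ℤ ⊎ x ⁻ ≡ 0ℤ
  ⁺-⁻-disjoint (+ n) = inj₂ refl
  ⁺-⁻-disjoint -[1+ n ] = inj₁ refl

  module _ {m n} (v : Fin m → Vector ℤ n)
           (obtuse : ∀ i j → ¬ i ≡ j → v i · v j < 0ℤ) where

    disjoint-combinations-obtuse : (p q : Fin m → ℤ) →
      (∀ i → 0ℤ ≤ p i) → (∀ i → 0ℤ ≤ q i) → (∀ i → p i ≡ 0ℤ ⊎ q i ≡ 0ℤ) →
      combination p v · combination q v ≤ 0ℤ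
    disjoint-combinations-obtuse p q p≥0 q≥0 disjoint =
      ≤-trans (≤-reflexive (combination-· p v (combination q v)))
              (sum-nonpos _ term≤0)
      where
      against-q≤0 : ∀ i → q i ≡ 0ℤ → v i · combination q v ≤ 0ℤ
      against-q≤0 i qᵢ≡0 = ≤-trans (≤-reflexive (trans (·-comm (v i) _) (combination-· q v (v i))))
                                   (sum-nonpos _ cross≤0)
        where
        cross≤0 : ∀ j → q j * (v j · v i) ≤ 0ℤ
        cross≤0 j with j ≟ᶠ i
        ... | yes refl = ≤-reflexive (cong (_* (v j · v j)) qᵢ≡0)
        ... | no j≢i = *-nonneg-nonpos (q≥0 j) (<⇒≤ (obtuse j i j≢i))
      term≤0 : ∀ i → p i * (v i · combination q v) ≤ 0ℤ
      term≤0 i with disjoint i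
      ... | inj₁ pᵢ≡0 = ≤-reflexive (cong (_* (v i · combination q v)) pᵢ≡0)
      ... | inj₂ qᵢ≡0 = *-nonneg-nonpos (p≥0 i) (against-q≤0 i qᵢ≡0)

    module _ (w : Vector ℤ n) (above : ∀ i → 0ℤ < v i · w) where

      -- A nonnegative combination of v that vanishes has all coefficients 0,
      -- since its inner product with w is a sum of nonnegative terms.
      nonneg-dependence-trivial : (a : Fin m → ℤ) → (∀ i → 0ℤ ≤ a i) →
        IsDependence a v → ∀ i → a i ≡ 0ℤ
      nonneg-dependence-trivial a a≥0 dep i
        with i*j≡0⇒i≡0∨j≡0 (a i) (sum-nonneg-vanishes _ terms≥0 Σ≤0 i)
        where
        terms≥0 : ∀ i → 0ℤ ≤ a i * (v i · w)
        terms≥0 i = *-nonneg (a≥0 i) (<⇒≤ (above i))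
        Σ≤0 : ∑[ i < m ] (a i * (v i · w)) ≤ 0ℤ
        Σ≤0 = ≤-reflexive (begin
          ∑[ i < m ] (a i * (v i · w))  ≡⟨ combination-· a v w ⟨
          combination a v · w           ≡⟨ sum-cong-≗ (λ k → cong (_* w k) (dep k)) ⟩
          sum (replicate n 0ℤ)          ≡⟨ sum-replicate-zero n ⟩
          0ℤ                            ∎)
          where open ≡-Reasoning
      ... | inj₁ aᵢ≡0 = aᵢ≡0
      ... | inj₂ vᵢ·w≡0 = contradiction (sym vᵢ·w≡0) (<⇒≢ (above i))

      obtuse-independent : (c : Fin m → ℤ) → IsDependence c v → ∀ i → c i ≡ 0ℤ
      obtuse-independent c dep i = begin
        c i              ≡⟨ ⁺-⁻-split (c i) ⟩
        c⁺ i - c⁻ i      ≡⟨ cong₂ _-_ (nonneg-dependence-trivial c⁺ (⁺-nonneg ∘ c) u⁺≡0 i)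
                                      (nonneg-dependence-trivial c⁻ (⁻-nonneg ∘ c) u⁻≡0 i) ⟩
        0ℤ               ∎
        where
        open ≡-Reasoning
        c⁺ c⁻ : Fin m → ℤ
        c⁺ i = c i ⁺
        c⁻ i = c i ⁻
        u⁺≡u⁻ : ∀ k → combination c⁺ v k ≡ combination c⁻ v k
        u⁺≡u⁻ k = i-j≡0⇒i≡j _ _ (begin
          combination c⁺ v k - combination c⁻ v k  ≡⟨ combination-difference c⁺ c⁻ v k ⟨
          combination (λ i → c⁺ i - c⁻ i) v k      ≡⟨ sum-cong-≗ (λ i → cong (_* v i k) (⁺-⁻-split (c i))) ⟨
          combination c v k                        ≡⟨ dep k ⟩
          0ℤ                                       ∎)
        u⁺≡0 : IsDependence c⁺ v
        u⁺≡0 = self-·-nonpos _ (≤-trans (≤-reflexive (sum-cong-≗ (λ k → cong (combination c⁺ v k *_) (u⁺≡u⁻ k))))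
                                        (disjoint-combinations-obtuse c⁺ c⁻ (⁺-nonneg ∘ c) (⁻-nonneg ∘ c) (⁺-⁻-disjoint ∘ c)))
        u⁻≡0 : IsDependence c⁻ v
        u⁻≡0 k = trans (sym (u⁺≡u⁻ k)) (u⁺≡0 k)

      obtuse-bound : m ℕ.≤ n
      obtuse-bound with m ℕ.≤? n
      ... | yes m≤n = m≤n
      ... | no m≰n with dependent n (≰⇒> m≰n) v
      ...   | c , (i , cᵢ≢0) , dep = contradiction (obtuse-independent c dep i) cᵢ≢0

module SignVectors where

  open IntegerVectors
  open import Data.Nat as ℕ using (ℕ; suc)
  open import Data.Nat.Properties using (<⇒≤; m<n⇒0<n∸m)
  open import Data.Integer using (ℤ; +_; 0ℤ; 1ℤ; -1ℤ; _+_; _*_; _-_; _⊖_; _<_; +<+)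
  open import Data.Integer.Properties using ([+m]-[+n]≡m⊖n; ⊖-≥; ⊖-<; neg-mono-<; pos-+; pos-*)
  open import Data.Integer.Tactic.RingSolver using (solve-∀)
  open import Data.Bool using (Bool; true; false; _∧_)
  open import Data.Vec using ([]; _∷_; lookup)
  open import Data.Vec.Functional using (Vector)
  open import Data.Fin.Subset using (Subset; ∣_∣; _∩_)
  open import Relation.Binary.PropositionalEquality

  private
    variable
      n : ℕ

  sign indicator : Bool → ℤ
  sign true = 1ℤ
  sign false = -1ℤ
  indicator true = 1ℤ
  indicator false = 0ℤ

  signVector : Subset n → Vector ℤ n
  signVector A k = sign (lookup A k)

  ones : Vector ℤ n
  ones _ = 1ℤ

  card-∷ : ∀ x (A : Subset n) → + ∣ x ∷ A ∣ ≡ indicator x + + ∣ A ∣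
  card-∷ true A = refl
  card-∷ false A = refl

  sign-product : ∀ x y → sign x * sign y + (+ 2 * indicator x + + 2 * indicator y) ≡ + 4 * indicator (x ∧ y) + 1ℤ
  sign-product true true = refl
  sign-product true false = refl
  sign-product false true = refl
  sign-product false false = refl

  sign-one : ∀ x → sign x * 1ℤ + 1ℤ ≡ + 2 * indicator x
  sign-one true = refl
  sign-one false = refl

  signVector-· : (A B : Subset n) →
    signVector A · signVector B + (+ 2 * + ∣ A ∣ + + 2 * + ∣ B ∣) ≡ + 4 * + ∣ A ∩ B ∣ + + n
  signVector-· [] [] = refl
  signVector-· {suc n} (x ∷ A) (y ∷ B) = begin
    sign x * sign y + S + (+ 2 * + ∣ x ∷ A ∣ + + 2 * + ∣ y ∷ B ∣)
      ≡⟨ cong₂ (λ a b → sign x * sign y + S + (+ 2 * a + + 2 * b)) (card-∷ x A) (card-∷ y B) ⟩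
    sign x * sign y + S + (+ 2 * (indicator x + + ∣ A ∣) + + 2 * (indicator y + + ∣ B ∣))
      ≡⟨ regroup (sign x * sign y) S (indicator x) (indicator y) (+ ∣ A ∣) (+ ∣ B ∣) ⟩
    (sign x * sign y + (+ 2 * indicator x + + 2 * indicator y)) + (S + (+ 2 * + ∣ A ∣ + + 2 * + ∣ B ∣))
      ≡⟨ cong₂ _+_ (sign-product x y) (signVector-· A B) ⟩
    (+ 4 * indicator (x ∧ y) + 1ℤ) + (+ 4 * + ∣ A ∩ B ∣ + + n)
      ≡⟨ collect (indicator (x ∧ y)) (+ ∣ A ∩ B ∣) (+ n) ⟩
    + 4 * (indicator (x ∧ y) + + ∣ A ∩ B ∣) + (1ℤ + + n)
      ≡⟨ cong (λ c → + 4 * c + + suc n) (card-∷ (x ∧ y) (A ∩ B)) ⟨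
    + 4 * + ∣ (x ∷ A) ∩ (y ∷ B) ∣ + + suc n ∎
    where
    open ≡-Reasoning
    S = signVector A · signVector B
    regroup : ∀ s S i j a b → s + S + (+ 2 * (i + a) + + 2 * (j + b)) ≡ (s + (+ 2 * i + + 2 * j)) + (S + (+ 2 * a + + 2 * b))
    regroup = solve-∀
    collect : ∀ i c n → (+ 4 * i + 1ℤ) + (+ 4 * c + n) ≡ + 4 * (i + c) + (1ℤ + n)
    collect = solve-∀

  signVector-ones : (A : Subset n) → signVector A · ones + + n ≡ + 2 * + ∣ A ∣
  signVector-ones [] = refl
  signVector-ones {suc n} (x ∷ A) = begin
    sign x * 1ℤ + S + (1ℤ + + n)          ≡⟨ regroup (sign x * 1ℤ) S (+ n) ⟩
    (sign x * 1ℤ + 1ℤ) + (S + + n)        ≡⟨ cong₂ _+_ (sign-one x) (signVector-ones A) ⟩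
    + 2 * indicator x + + 2 * + ∣ A ∣      ≡⟨ collect (indicator x) (+ ∣ A ∣) ⟩
    + 2 * (indicator x + + ∣ A ∣)          ≡⟨ cong (+ 2 *_) (card-∷ x A) ⟨
    + 2 * + ∣ x ∷ A ∣                      ∎
    where
    open ≡-Reasoning
    S = signVector A · ones
    regroup : ∀ s S n → s + S + (1ℤ + n) ≡ (s + 1ℤ) + (S + n)
    regroup = solve-∀
    collect : ∀ i a → + 2 * i + + 2 * a ≡ + 2 * (i + a)
    collect = solve-∀

  shift-⊖ : ∀ S a b → S + + a ≡ + b → S ≡ b ⊖ a
  shift-⊖ S a b S+a≡b = begin
    S              ≡⟨ unshift S (+ a) ⟩
    S + + a - + a  ≡⟨ cong (_- + a) S+a≡b ⟩
    + b - + a      ≡⟨ [+m]-[+n]≡m⊖n b a ⟩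
    b ⊖ a          ∎
    where
    open ≡-Reasoning
    unshift : ∀ S a → S ≡ S + a - a
    unshift = solve-∀

  shift-positive : ∀ S a b → S + + a ≡ + b → a ℕ.< b → 0ℤ < S
  shift-positive S a b S+a≡b a<b
    rewrite shift-⊖ S a b S+a≡b | ⊖-≥ (<⇒≤ a<b) = +<+ (m<n⇒0<n∸m a<b)

  shift-negative : ∀ S a b → S + + a ≡ + b → b ℕ.< a → S < 0ℤ
  shift-negative S a b S+a≡b b<a
    rewrite shift-⊖ S a b S+a≡b | ⊖-< b<a = neg-mono-< (+<+ (m<n⇒0<n∸m b<a))

  signVector-obtuse : (A B : Subset n) → 4 ℕ.* ∣ A ∩ B ∣ ℕ.+ n ℕ.< 2 ℕ.* ∣ A ∣ ℕ.+ 2 ℕ.* ∣ B ∣ →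
    signVector A · signVector B < 0ℤ
  signVector-obtuse {n} A B small = shift-negative _ _ _ (begin
    signVector A · signVector B + + (2 ℕ.* ∣ A ∣ ℕ.+ 2 ℕ.* ∣ B ∣)
      ≡⟨ cong (_+_ (signVector A · signVector B)) (linear 2 (∣ A ∣) 2 (∣ B ∣)) ⟩
    signVector A · signVector B + (+ 2 * + ∣ A ∣ + + 2 * + ∣ B ∣)
      ≡⟨ signVector-· A B ⟩
    + 4 * + ∣ A ∩ B ∣ + + n
      ≡⟨ cong (_+ + n) (pos-* 4 ∣ A ∩ B ∣) ⟨
    + (4 ℕ.* ∣ A ∩ B ∣) + + n
      ≡⟨ pos-+ (4 ℕ.* ∣ A ∩ B ∣) n ⟨
    + (4 ℕ.* ∣ A ∩ B ∣ ℕ.+ n) ∎) small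
    where
    open ≡-Reasoning
    linear : ∀ p x q y → + (p ℕ.* x ℕ.+ q ℕ.* y) ≡ + p * + x + + q * + y
    linear p x q y = trans (pos-+ (p ℕ.* x) (q ℕ.* y)) (cong₂ _+_ (pos-* p x) (pos-* q y))

  signVector-positive : (A : Subset n) → n ℕ.< 2 ℕ.* ∣ A ∣ → 0ℤ < signVector A · ones
  signVector-positive {n} A large =
    shift-positive _ n _ (trans (signVector-ones A) (sym (pos-* 2 ∣ A ∣))) large

module DensityArithmetic where

  open import Data.Nat
  open import Data.Nat.Properties
  open import Data.Nat.Tactic.RingSolver using (solve-∀)
  open import Data.Product using (_,_)
  open import Relation.Binary.PropositionalEquality
  open import Relation.Nullary using (yes; no)

  -- Rearrangement inequality (y - x)(v - u) ≥ 0, stated without subtraction.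
  rearrangement : ∀ {x y u v} → x ≤ y → u ≤ v → x * v + y * u ≤ x * u + y * v
  rearrangement {x} {_} {u} x≤y u≤v with m≤n⇒∃[o]m+o≡n x≤y | m≤n⇒∃[o]m+o≡n u≤v
  ... | e , refl | f , refl = subst (x * (u + f) + (x + e) * u ≤_) (sym (expand x e u f)) (m≤m+n _ (e * f))
    where
    expand : ∀ x e u f → x * u + (x + e) * (u + f) ≡ x * (u + f) + (x + e) * u + e * f
    expand = solve-∀

  -- If B is above the threshold, then 4a|A| + bn < 2b(|A| + |B|) for every |A| ≤ n:
  -- when 2b ≤ 4a the worst case is |A| = n, otherwise it is |A| = 0.
  density-bound : ∀ a b X Y n → 0 < b → X ≤ n → AboveAlpha (a , b) n Y →
    4 * a * X + b * n < 2 * b * X + 2 * b * Y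
  density-bound a b X Y n b>0 X≤n (n<2Y , above) with 2 * b ≤? 4 * a
  ... | yes 2b≤4a = +-cancelʳ-< (b * n) _ _ (begin-strict
    4 * a * X + b * n + b * n          ≡⟨ regroup a b X n ⟩
    X * (4 * a) + n * (2 * b)          ≤⟨ rearrangement X≤n 2b≤4a ⟩
    X * (2 * b) + n * (4 * a)          ≡⟨ swap a b X n ⟩
    2 * b * X + 4 * a * n              <⟨ +-monoʳ-< (2 * b * X) above ⟩
    2 * b * X + (2 * b * Y + b * n)    ≡⟨ +-assoc (2 * b * X) (2 * b * Y) (b * n) ⟨
    2 * b * X + 2 * b * Y + b * n      ∎)
    where
    open ≤-Reasoning
    regroup : ∀ a b X n → 4 * a * X + b * n + b * n ≡ X * (4 * a) + n * (2 * b)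
    regroup = solve-∀
    swap : ∀ a b X n → X * (2 * b) + n * (4 * a) ≡ 2 * b * X + 4 * a * n
    swap = solve-∀
  ... | no 2b≰4a = +-mono-≤-< (*-monoˡ-≤ X (<⇒≤ (≰⇒> 2b≰4a)))
                              (subst (b * n <_) (double b Y) (*-monoʳ-< b n<2Y))
    where
    instance _ = >-nonZero b>0
    double : ∀ b Y → b * (2 * Y) ≡ 2 * b * Y
    double = solve-∀

  fraction-bound : ∀ a b a' b' I X → 0 < b' → a' * b ≤ a * b' →
    IsFracOf (a' , b') I X → b * I ≤ a * X
  fraction-bound a b a' b' I X b'>0 a'/b'≤a/b I≡a'/b'X = *-cancelˡ-≤ b' (begin
    b' * (b * I)    ≡⟨ x*[y*z]≡y*[x*z] b' b I ⟩
    b * (b' * I)    ≡⟨ cong (b *_) I≡a'/b'X ⟩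
    b * (a' * X)    ≡⟨ x*[y*z]≡y*[x*z] b a' X ⟩
    a' * (b * X)    ≡⟨ *-assoc a' b X ⟨
    a' * b * X      ≤⟨ *-monoˡ-≤ X a'/b'≤a/b ⟩
    a * b' * X      ≡⟨ trans (cong (_* X) (*-comm a b')) (*-assoc b' a X) ⟩
    b' * (a * X)    ∎)
    where
    open ≤-Reasoning
    instance _ = >-nonZero b'>0
    x*[y*z]≡y*[x*z] : ∀ x y z → x * (y * z) ≡ y * (x * z)
    x*[y*z]≡y*[x*z] = solve-∀

  small-intersection : ∀ a b a' b' I X Y n → 0 < b → 0 < b' → a' * b ≤ a * b' →
    IsFracOf (a' , b') I X → X ≤ n → AboveAlpha (a , b) n Y → 4 * I + n < 2 * X + 2 * Y
  small-intersection a b a' b' I X Y n b>0 b'>0 a'/b'≤a/b I≡a'/b'X X≤n Y-above =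
    *-cancelˡ-< b (4 * I + n) (2 * X + 2 * Y) (begin-strict
      b * (4 * I + n)            ≡⟨ spread b I n ⟩
      4 * (b * I) + b * n        ≤⟨ +-monoˡ-≤ (b * n) (*-monoʳ-≤ 4 (fraction-bound a b a' b' I X b'>0 a'/b'≤a/b I≡a'/b'X)) ⟩
      4 * (a * X) + b * n        ≡⟨ cong (_+ b * n) (*-assoc 4 a X) ⟨
      4 * a * X + b * n          <⟨ density-bound a b X Y n b>0 X≤n Y-above ⟩
      2 * b * X + 2 * b * Y      ≡⟨ collect b X Y ⟩
      b * (2 * X + 2 * Y)        ∎)
    where
    open ≤-Reasoning
    spread : ∀ b I n → b * (4 * I + n) ≡ 4 * (b * I) + b * n
    spread = solve-∀
    collect : ∀ b X Y → 2 * b * X + 2 * b * Y ≡ b * (2 * X + 2 * Y)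
    collect = solve-∀

open ObtuseFamilies using (obtuse-bound)
open SignVectors using (signVector; ones; signVector-obtuse; signVector-positive)
open DensityArithmetic using (small-intersection)

open import Data.Nat using (ℕ; _≤_; _>_; _<_; _+_; _*_; z≤n)
open import Data.Nat.Properties using (≤-<-trans; +-comm)
open import Data.Fin using (Fin)
open import Data.Fin.Subset using (Subset; ∣_∣; _∩_)
open import Data.Fin.Subset.Properties using (∣p∣≤n)
open import Data.Product using (_,_; proj₁)
open import Data.Sum using (inj₁; inj₂)
open import Data.List using (List)
open import Data.List.Relation.Unary.All using (All)
import Data.List.Relation.Unary.All as All
open import Function.Definitions using (Injective)
open import Relation.Binary.PropositionalEquality using (_≡_; subst)
open import Relation.Nullary using (¬_)

denominator-positive : ∀ {a b} → IrredIn01 (a , b) → 0 < b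
denominator-positive (_ , a<b) = ≤-<-trans z≤n a<b

theorem3 : (n : ℕ) → n > 0 → (L : List Frac) → All IrredIn01 L →
    (a b : ℕ) → IsMax (a , b) L →
    (m : ℕ) → (F : Fin m → Subset n) → Injective _≡_ _≡_ F →
    FractionalLIntersecting L F →
    (∀ i → AboveAlpha (a , b) n ∣ F i ∣) →
    m ≤ n
theorem3 n _ L inL a b (a/b∈L , a/b-max) m F _ intersecting above =
  obtuse-bound (λ i → signVector (F i))
               (λ i j i≢j → signVector-obtuse (F i) (F j) (small i j i≢j))
               ones (λ i → signVector-positive (F i) (proj₁ (above i)))
  where
  b>0 : 0 < b
  b>0 = denominator-positive (All.lookup inL a/b∈L)

  -- Distinct members meet in a fraction a'/b' ≤ a/b of one of them, while the
  -- other lies above the threshold; so their intersection is small.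
  small : ∀ i j → ¬ (i ≡ j) → 4 * ∣ F i ∩ F j ∣ + n < 2 * ∣ F i ∣ + 2 * ∣ F j ∣
  small i j i≢j with intersecting i j i≢j
  ... | (a' , b') , q∈L , inj₁ ofFi =
    small-intersection a b a' b' _ _ _ n b>0 (denominator-positive (All.lookup inL q∈L))
      (All.lookup a/b-max q∈L) ofFi (∣p∣≤n (F i)) (above j)
  ... | (a' , b') , q∈L , inj₂ ofFj = subst (4 * ∣ F i ∩ F j ∣ + n <_) (+-comm (2 * ∣ F j ∣) _)
    (small-intersection a b a' b' _ _ _ n b>0 (denominator-positive (All.lookup inL q∈L))
      (All.lookup a/b-max q∈L) ofFj (∣p∣≤n (F j)) (above i))
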